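{- A sentential logic is monotonic if and only if it has a truth-adequate intersective mixed semantics.
   Context: A sentential logic is a triple $\langle\mathcal{L},\mathcal{C},\vdash\rangle$ where $\mathcal{L}$ is the set of formulae freely generated from a set of atoms by a (possibly empty) set $\mathcal{C}$ of connectives, and $\vdash\subseteq\mathcal{P}(\mathcal{L})\times\mathcal{P}(\mathcal{L})$. It is monotonic if $\Gamma_1\subseteq\Gamma_2$, $\Delta_1\subseteq\Delta_2$ and $\Gamma_1\vdash\Delta_1$ imply $\Gamma_2\vdash\Delta_2$. A semantics is a triple $\langle\mathcal{V},\mathcal{W},[\![\cdot]\!]\rangle$: truth values $\mathcal{V}$, worlds $\mathcal{W}$, and $[\![\cdot]\!]$ assigning to formulae propositions $\mathcal{W}\to\mathcal{V}$, to $n$-ary connectives functions on $n$-tuples of propositions, and to $\vdash$ a relation $\models$ between sets of propositions. It is compositional if $[\![c(F_1,\dots,F_n)]\!]=[\![c]\!]([\![F_1]\!],\dots,[\![F_n]\!])$; sound and complete if $\Gamma\vdash\Delta$ iff $\{[\![F]\!]:F\in\Gamma\}\models\{[\![F]\!]:F\in\Delta\}$; truth-functional if for each $n$-ary $c$ there is $f_c:\mathcal{V}^n\to\mathcal{V}$ with $[\![c]\!](P_1,\dots,P_n)(w)=f_c(P_1(w),\dots,P_n(w))$ for all propositions and worlds; truth-relational if there is $\Vdash\subseteq\mathcal{P}(\mathcal{V})\times\mathcal{P}(\mathcal{V})$ (the truth-relation) with $S\models P$ iff $S(w)\Vdash P(w)$ for all $w\in\mathcal{W}$, where $S(w)=\{Q(w):Q\in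 S\}$; truth-adequate if it has all four properties. For $D_p,D_c\subseteq\mathcal{V}$, $\gamma\Vdash_{D_p,D_c}\delta$ iff ($\gamma\subseteq D_p$ implies $\delta\cap D_c\neq\emptyset$) (a mixed relation). A semantics is intersective mixed if it is truth-relational and its truth-relation is the intersection of a (possibly empty; the empty intersection being $\mathcal{P}(\mathcal{V})\times\mathcal{P}(\mathcal{V})$) family of mixed relations. -}

module Defs where

open import Level using (0ℓ)
open import Data.Nat using (ℕ)
open import Data.Vec using (Vec; map)
open import Data.Product using (Σ; ∃; _×_; _,_)
open import Relation.Unary using (Pred; _⊆_; _∩_; Empty; _∈_)
open import Relation.Nullary using (¬_)
open import Relation.Binary.PropositionalEquality using (_≡_)
open import Function.Bundles using (_⇔_)

Subset : Set → Set₁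
Subset X = Pred X 0ℓ

data Formula (Atom Conn : Set) (arity : Conn → ℕ) : Set where
  atom : Atom → Formula Atom Conn arity
  app  : (c : Conn) → Vec (Formula Atom Conn arity) (arity c) → Formula Atom Conn arity

record Logic : Set₁ where
  field
    Atom  : Set
    Conn  : Set
    arity : Conn → ℕ
  Fm : Set
  Fm = Formula Atom Conn arity
  field
    _⊢_ : Subset Fm → Subset Fm → Set

Monotonic : Logic → Set₁
Monotonic L = ∀ (Γ₁ Γ₂ Δ₁ Δ₂ : Subset Fm) → Γ₁ ⊆ Γ₂ → Δ₁ ⊆ Δ₂ → Γ₁ ⊢ Δ₁ → Γ₂ ⊢ Δ₂
  where open Logic L

record Semantics (L : Logic) : Set₁ where
  open Logic L
  field
    V : Set   -- truth values
    W : Set   -- worlds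
  Prop : Set
  Prop = W → V
  field
    ⟦_⟧   : Fm → Prop
    ⟦_⟧ᶜ  : (c : Conn) → Vec Prop (arity c) → Prop
    _⊨_   : Subset Prop → Subset Prop → Set

⟦_⟧ˢ : ∀ {L} {S : Semantics L} → Subset (Logic.Fm L) → Subset (Semantics.Prop S)
⟦_⟧ˢ {S = S} Γ P = ∃ λ F → F ∈ Γ × Semantics.⟦_⟧ S F ≡ P

module _ {L : Logic} (S : Semantics L) where
  open Logic L
  open Semantics S

  Compositional : Set
  Compositional = ∀ (c : Conn) (Fs : Vec Fm (arity c)) →
    ⟦ app c Fs ⟧ ≡ ⟦ c ⟧ᶜ (map ⟦_⟧ Fs)

  SoundComplete : Set₁
  SoundComplete = ∀ (Γ Δ : Subset Fm) →
    (Γ ⊢ Δ) ⇔ (⟦_⟧ˢ {S = S} Γ ⊨ ⟦_⟧ˢ {S = S} Δ)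

  TruthFunctional : Set
  TruthFunctional = ∀ (c : Conn) → ∃ λ (f : Vec V (arity c) → V) →
    ∀ (Ps : Vec Prop (arity c)) (w : W) → ⟦ c ⟧ᶜ Ps w ≡ f (map (λ P → P w) Ps)

  at : Subset Prop → W → Subset V
  at T w v = ∃ λ Q → Q ∈ T × Q w ≡ v

  IsTruthRelation : (Subset V → Subset V → Set) → Set₁
  IsTruthRelation _⊩_ = ∀ (T P : Subset Prop) → (T ⊨ P) ⇔ (∀ (w : W) → at T w ⊩ at P w)

  TruthRelational : Set₁
  TruthRelational = ∃ λ (_⊩_ : Subset V → Subset V → Set) → IsTruthRelation _⊩_

  TruthAdequate : Set₁
  TruthAdequate = Compositional × SoundComplete × TruthFunctional × TruthRelational

  Mixed : Subset V → Subset V → Subset V → Subset V → Set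
  Mixed Dp Dc γ δ = γ ⊆ Dp → ¬ Empty (δ ∩ Dc)

  IntersectiveMixed : Set₂
  IntersectiveMixed =
    ∃ λ (_⊩_ : Subset V → Subset V → Set) → IsTruthRelation _⊩_ ×
      (∃ λ (I : Set₁) → ∃ λ (Dp : I → Subset V) → ∃ λ (Dc : I → Subset V) →
        ∀ (γ δ : Subset V) → (γ ⊩ δ) ⇔ (∀ (i : I) → Mixed (Dp i) (Dc i) γ δ))

-- A semantics transfers monotonicity from its truth-relation to ⊢: a mixed
-- relation is monotone, hence so is any intersection of them, hence so is ⊨
-- (the sets S(w) grow with S), hence so is ⊢ by soundness and completeness.
-- Conversely, a monotonic logic is its own truth-adequate semantics: one world,
-- formulae as truth values, ⊢ as truth-relation. Classically, a monotone
-- relation is the intersection of the mixed relations ⊩_{Γ, ∁Δ} over the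
-- underivable pairs Γ ⊬ Δ.
module Submission where

open import Defs
open import Level using (0ℓ)
open import Data.Product using (∃; _×_; _,_; Σ)
open import Function.Bundles using (_⇔_; mk⇔; Equivalence)
open import Axiom.ExcludedMiddle using (ExcludedMiddle)
open import Data.Unit using (⊤; tt)
open import Data.Vec using (Vec; []; _∷_; map)
open import Relation.Unary using (_⊆_; _∈_; ∁; _∩_; Empty)
open import Relation.Nullary using (¬_; yes; no; contradiction)
open import Relation.Binary.PropositionalEquality using (_≡_; refl; sym; trans; cong; cong₂; subst)

open Equivalence

MonotoneRel : {X : Set} → (Subset X → Subset X → Set) → Set₁
MonotoneRel {X} _R_ = ∀ {γ₁ γ₂ δ₁ δ₂ : Subset X} → γ₁ ⊆ γ₂ → δ₁ ⊆ δ₂ → γ₁ R δ₁ → γ₂ R δ₂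

monotonic⇔monotoneRel : (L : Logic) → Monotonic L ⇔ MonotoneRel (Logic._⊢_ L)
monotonic⇔monotoneRel L =
  mk⇔ (λ mono {γ₁} {γ₂} {δ₁} {δ₂} → mono γ₁ γ₂ δ₁ δ₂) (λ mono Γ₁ Γ₂ Δ₁ Δ₂ → mono {Γ₁} {Γ₂} {Δ₁} {Δ₂})

monotoneRel-⋂ : ∀ {X : Set} {I : Set₁} {_R_ : Subset X → Subset X → Set}
  (_Rᵢ_ : I → Subset X → Subset X → Set) →
  (∀ γ δ → γ R δ ⇔ (∀ i → _Rᵢ_ i γ δ)) → (∀ i → MonotoneRel (_Rᵢ_ i)) → MonotoneRel _R_
monotoneRel-⋂ _ R⇔⋂ monoᵢ γ⊆ δ⊆ r =
  from (R⇔⋂ _ _) λ i → monoᵢ i γ⊆ δ⊆ (to (R⇔⋂ _ _) r i)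

Counterexample : {X : Set} → (Subset X → Subset X → Set) → Set₁
Counterexample {X} _R_ = Σ (Subset X × Subset X) λ { (Γ , Δ) → ¬ Γ R Δ }

module _ {X : Set} {_R_ : Subset X → Subset X → Set} where

  premises : Counterexample _R_ → Subset X
  premises ((Γ , _) , _) = Γ

  conclusions : Counterexample _R_ → Subset X
  conclusions ((_ , Δ) , _) = Δ

monotoneRel⇔⋂mixed : ExcludedMiddle 0ℓ → ∀ {X : Set} {_R_ : Subset X → Subset X → Set} →
  MonotoneRel _R_ → ∀ γ δ →
  γ R δ ⇔ (∀ (i : Counterexample _R_) →
             γ ⊆ premises i → ¬ Empty (δ ∩ ∁ (conclusions i)))
monotoneRel⇔⋂mixed lem {_R_ = _R_} mono γ δ = mk⇔ inAll fromAll
  where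
  ⋂Mixed : Set₁
  ⋂Mixed = ∀ i → γ ⊆ premises i → ¬ Empty (δ ∩ ∁ (conclusions i))

  inAll : γ R δ → ⋂Mixed
  inAll γRδ ((Γ , Δ) , Γ⊬Δ) γ⊆Γ δ∩∁Δ-empty = Γ⊬Δ (mono γ⊆Γ δ⊆Δ γRδ)
    where
    δ⊆Δ : δ ⊆ Δ
    δ⊆Δ {x} x∈δ with lem {x ∈ Δ}
    ... | yes x∈Δ = x∈Δ
    ... | no  x∉Δ = contradiction (x∈δ , x∉Δ) (δ∩∁Δ-empty x)

  fromAll : ⋂Mixed → γ R δ
  fromAll h with lem {γ R δ}
  ... | yes γRδ = γRδ
  ... | no  γ⊬δ = contradiction (λ x (x∈δ , x∉δ) → x∉δ x∈δ) (h ((γ , δ) , γ⊬δ) (λ x∈γ → x∈γ))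

module _ {L : Logic} (S : Semantics L) where
  open Logic L
  open Semantics S

  mixed-monotoneRel : ∀ Dp Dc → MonotoneRel (Mixed S Dp Dc)
  mixed-monotoneRel Dp Dc γ₁⊆γ₂ δ₁⊆δ₂ m γ₂⊆Dp δ₂∩Dc-empty =
    m (λ v∈γ₁ → γ₂⊆Dp (γ₁⊆γ₂ v∈γ₁)) (λ v (v∈δ₁ , v∈Dc) → δ₂∩Dc-empty v (δ₁⊆δ₂ v∈δ₁ , v∈Dc))

  at-mono : ∀ {T T′ : Subset Prop} → T ⊆ T′ → ∀ w → at S T w ⊆ at S T′ w
  at-mono T⊆T′ w (Q , Q∈T , Qw≡v) = Q , T⊆T′ Q∈T , Qw≡v

  image-mono : ∀ {Γ Γ′ : Subset Fm} → Γ ⊆ Γ′ → ⟦_⟧ˢ {S = S} Γ ⊆ ⟦_⟧ˢ {S = S} Γ′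
  image-mono Γ⊆Γ′ (F , F∈Γ , ⟦F⟧≡P) = F , Γ⊆Γ′ F∈Γ , ⟦F⟧≡P

  truthRelation-monotoneRel : ∀ {_⊩_} → IsTruthRelation S _⊩_ → MonotoneRel _⊩_ → MonotoneRel _⊨_
  truthRelation-monotoneRel ⊨⇔⊩ mono T⊆ P⊆ T⊨P =
    from (⊨⇔⊩ _ _) λ w → mono (at-mono T⊆ w) (at-mono P⊆ w) (to (⊨⇔⊩ _ _) T⊨P w)

  soundComplete-monotonic : SoundComplete S → MonotoneRel _⊨_ → Monotonic L
  soundComplete-monotonic ⊢⇔⊨ mono = from (monotonic⇔monotoneRel L) λ Γ⊆ Δ⊆ Γ⊢Δ →
    from (⊢⇔⊨ _ _) (mono (image-mono Γ⊆) (image-mono Δ⊆) (to (⊢⇔⊨ _ _) Γ⊢Δ))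

  intersectiveMixed-monotonic : TruthAdequate S → IntersectiveMixed S → Monotonic L
  intersectiveMixed-monotonic (_ , ⊢⇔⊨ , _ , _) (_ , ⊨⇔⊩ , _ , Dp , Dc , ⊩⇔⋂) =
    soundComplete-monotonic ⊢⇔⊨
      (truthRelation-monotoneRel ⊨⇔⊩
        (monotoneRel-⋂ (λ i → Mixed S (Dp i) (Dc i)) ⊩⇔⋂ (λ i → mixed-monotoneRel (Dp i) (Dc i))))

module Canonical (L : Logic) where
  open Logic L

  valueAt : ∀ {n} → Vec (⊤ → Fm) n → Vec Fm n
  valueAt Ps = map (λ P → P tt) Ps

  conn : (c : Conn) → Vec (⊤ → Fm) (arity c) → ⊤ → Fm
  conn c Ps _ = app c (valueAt Ps)

  -- Morally ⟦F⟧ = λ _ → F; it is built by recursion so that compositionality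
  -- holds without function extensionality.
  mutual
    ⟦_⟧ : Fm → ⊤ → Fm
    ⟦ atom a ⟧   = λ _ → atom a
    ⟦ app c Fs ⟧ = conn c (⟦ Fs ⟧*)

    ⟦_⟧* : ∀ {n} → Vec Fm n → Vec (⊤ → Fm) n
    ⟦ [] ⟧*     = []
    ⟦ F ∷ Fs ⟧* = ⟦ F ⟧ ∷ ⟦ Fs ⟧*

  ⟦⟧*≡map : ∀ {n} (Fs : Vec Fm n) → ⟦ Fs ⟧* ≡ map ⟦_⟧ Fs
  ⟦⟧*≡map []       = refl
  ⟦⟧*≡map (F ∷ Fs) = cong (⟦ F ⟧ ∷_) (⟦⟧*≡map Fs)

  mutual
    ⟦⟧-at : ∀ F w → ⟦ F ⟧ w ≡ F
    ⟦⟧-at (atom a)   w = refl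
    ⟦⟧-at (app c Fs) w = cong (app c) (⟦⟧*-at Fs)

    ⟦⟧*-at : ∀ {n} (Fs : Vec Fm n) → valueAt ⟦ Fs ⟧* ≡ Fs
    ⟦⟧*-at []       = refl
    ⟦⟧*-at (F ∷ Fs) = cong₂ _∷_ (⟦⟧-at F tt) (⟦⟧*-at Fs)

  semantics : Semantics L
  semantics = record
    { V = Fm ; W = ⊤ ; ⟦_⟧ = ⟦_⟧ ; ⟦_⟧ᶜ = conn
    ; _⊨_ = λ T P → ∀ w → at′ T w ⊢ at′ P w }
    where
    at′ : Subset (⊤ → Fm) → ⊤ → Subset Fm
    at′ T w F = ∃ λ Q → Q ∈ T × Q w ≡ F

  ⊆-at-image : ∀ Γ w → Γ ⊆ at semantics (⟦_⟧ˢ {S = semantics} Γ) w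
  ⊆-at-image Γ w {F} F∈Γ = ⟦ F ⟧ , (F , F∈Γ , refl) , ⟦⟧-at F w

  at-image-⊆ : ∀ Γ w → at semantics (⟦_⟧ˢ {S = semantics} Γ) w ⊆ Γ
  at-image-⊆ Γ w (_ , (F , F∈Γ , refl) , ⟦F⟧w≡G) = subst (_∈ Γ) (trans (sym (⟦⟧-at F w)) ⟦F⟧w≡G) F∈Γ

  compositional : Compositional semantics
  compositional c Fs = cong (conn c) (⟦⟧*≡map Fs)

  truthFunctional : TruthFunctional semantics
  truthFunctional c = app c , λ _ _ → refl

  isTruthRelation : IsTruthRelation semantics _⊢_
  isTruthRelation _ _ = mk⇔ (λ T⊨P → T⊨P) (λ T⊨P → T⊨P)

  module _ (mono : MonotoneRel _⊢_) where

    soundComplete : SoundComplete semantics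
    soundComplete Γ Δ = mk⇔
      (λ Γ⊢Δ w → mono (⊆-at-image Γ w) (⊆-at-image Δ w) Γ⊢Δ)
      (λ ⟦Γ⟧⊨⟦Δ⟧ → mono (at-image-⊆ Γ tt) (at-image-⊆ Δ tt) (⟦Γ⟧⊨⟦Δ⟧ tt))

    truthAdequate : TruthAdequate semantics
    truthAdequate = compositional , soundComplete , truthFunctional , (_⊢_ , isTruthRelation)

    intersectiveMixed : ExcludedMiddle 0ℓ → IntersectiveMixed semantics
    intersectiveMixed lem =
      _⊢_ , isTruthRelation , Counterexample _⊢_ , premises , (λ i → ∁ (conclusions i))
          , monotoneRel⇔⋂mixed lem mono

theorem3p2 : ExcludedMiddle 0ℓ → (L : Logic) →
    Monotonic L ⇔ (∃ λ (S : Semantics L) → TruthAdequate S × IntersectiveMixed S)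
theorem3p2 lem L = mk⇔ canonical (λ (S , adequate , mixed) → intersectiveMixed-monotonic S adequate mixed)
  where
  open Canonical L
  canonical : Monotonic L → ∃ λ (S : Semantics L) → TruthAdequate S × IntersectiveMixed S
  canonical monotonic = semantics , truthAdequate mono , intersectiveMixed mono lem
    where
    mono : MonotoneRel (Logic._⊢_ L)
    mono = to (monotonic⇔monotoneRel L) monotonic
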